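{- Let $G$ be a connected graph and let $V(G)=X\cup Y$ be a partition. Let $H$ be the subgraph of $G$ formed by the edges in $E[X]\cup E[X,Y]$. Suppose there is an orientation of the edges of $E[X]\cup E[X,Y]$ and a mapping $\phi: E[X]\cup E[X,Y]\to E[X]$ such that for each $e\in E[X]\cup E[X,Y]$, $\phi(e)\neq e$ is an edge sharing an end vertex with $e$ which is a source edge or a sink edge (with respect to this orientation), and for each $e\in E[X]$, $|\phi^{ -1}(e)|\le 2$. Then $H$ has a permanent-non-singular $(0,2)$-matrix which contains no column indexed by an edge of $E[X,Y]$.
   Context: Graphs are finite and simple. For $X,Y\subseteq V(G)$, $E[X,Y]$ denotes the set of edges with one end in $X$ and the other in $Y$, and $E[X]=E[X,X]$. In an oriented graph, an edge $e$ is a sink edge if every edge $e'\neq e$ sharing an end vertex with $e$ is oriented towards that common end vertex, and a source edge if every such $e'$ is oriented away from the common end vertex. For a graph $H$ with an orientation, let $A_H$ be the matrix whose rows are indexed by $E(H)$ and whose columns are indexed by $V(H)\cup E(H)$. For an edge $e$ oriented from $u$ to $v$ and $z\in V(H)\cup E(H)$: $A_H[e,z]=1$ if $z=v$ or $z\neq e$ is an edge incident to $v$; $A_H[e,z]=-1$ if $z=u$ or $z\neq e$ is an edge incident to $u$; and $A_H[e,z]=0$ otherwise. An index function is a map $\eta:V(H)\cup E(H)\to\{0,1,2,\dots\}$; $A_H(\eta)$ denotes the matrix whose columns are columns of $A_H$, with the column indexed by $z$ occurring exactly $\eta(z)$ times. A $(0,2)$-matrix of $H$ is a square matrix $A_H(\eta)$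 with $\eta(v)=0$ for every vertex $v$ and $\eta(e)\le 2$ for every edge $e$. A square matrix is permanent-non-singular if its permanent is nonzero. (Whether the permanent is nonzero does not depend on the orientation used to define $A_H$.) -}

module Defs where

open import Data.Nat using (ℕ; zero; suc; _≤_)
open import Data.Integer using (ℤ; +_; -_; _*_; _+_)
open import Data.Fin using (Fin; zero; suc; punchIn; cast; _≟_)
open import Data.Bool using (Bool; true; false; _∧_; _∨_; if_then_else_)
open import Data.List using (List; filterᵇ; concatMap; replicate; allFin; length; lookup)
open import Data.Product using (_×_; _,_; proj₁; proj₂; Σ; ∃)
open import Data.Sum using (_⊎_)
open import Relation.Nullary using (¬_; does)
open import Relation.Binary.PropositionalEquality using (_≡_; _≢_; sym)

record Graph : Set where
  field
    n : ℕ
    m : ℕ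
    ends : Fin m → Fin n × Fin n
    loopless : ∀ e → proj₁ (ends e) ≢ proj₂ (ends e)
    noParallel : ∀ e f →
      (ends e ≡ ends f ⊎ (proj₁ (ends e) ≡ proj₂ (ends f) × proj₂ (ends e) ≡ proj₁ (ends f))) →
      e ≡ f

module _ (G : Graph) where
  open Graph G

  Incident : Fin n → Fin m → Set
  Incident v e = proj₁ (ends e) ≡ v ⊎ proj₂ (ends e) ≡ v

  incidentᵇ : Fin n → Fin m → Bool
  incidentᵇ v e = does (proj₁ (ends e) ≟ v) ∨ does (proj₂ (ends e) ≟ v)

  Adjacent : Fin n → Fin n → Set
  Adjacent u v = ∃ λ e → ends e ≡ (u , v) ⊎ ends e ≡ (v , u)

  data Reachable : Fin n → Fin n → Set where
    here : ∀ {u} → Reachable u u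
    step : ∀ {u v w} → Adjacent u v → Reachable v w → Reachable u w

  Connected : Set
  Connected = ∀ u v → Reachable u v

  -- X ⊆ V(G) given by its indicator; Y is its complement.
  -- e ∈ E[X]
  inEX : (Fin n → Bool) → Fin m → Bool
  inEX X e = X (proj₁ (ends e)) ∧ X (proj₂ (ends e))

  inH : (Fin n → Bool) → Fin m → Bool
  inH X e = X (proj₁ (ends e)) ∨ X (proj₂ (ends e))

  tailO headO : (Fin m → Bool) → Fin m → Fin n
  tailO o e = if o e then proj₁ (ends e) else proj₂ (ends e)
  headO o e = if o e then proj₂ (ends e) else proj₁ (ends e)

  SinkEdge : (Fin n → Bool) → (Fin m → Bool) → Fin m → Set
  SinkEdge X o e = ∀ e' w → inH X e' ≡ true → e' ≢ e →
    Incident w e → Incident w e' → headO o e' ≡ w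

  SourceEdge : (Fin n → Bool) → (Fin m → Bool) → Fin m → Set
  SourceEdge X o e = ∀ e' w → inH X e' ≡ true → e' ≢ e →
    Incident w e → Incident w e' → tailO o e' ≡ w

  ShareEnd : Fin m → Fin m → Set
  ShareEnd e f = ∃ λ w → Incident w e × Incident w f

  rowsH : (Fin n → Bool) → List (Fin m)
  rowsH X = filterᵇ (inH X) (allFin m)

  -- columns of A_H(η) restricted to edge columns, η given on edges
  colsη : (Fin m → ℕ) → List (Fin m)
  colsη η = concatMap (λ e → replicate (η e) e) (allFin m)

  entryA : (Fin m → Bool) → Fin m → Fin m → ℤ
  entryA o e f =
    if does (e ≟ f) then + 0
    else if incidentᵇ (headO o e) f then + 1
    else if incidentᵇ (tailO o e) f then - (+ 1)
    else + 0

  preimageSize : (Fin n → Bool) → (Fin m → Fin m) → Fin m → ℕ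
  preimageSize X φ e = length (filterᵇ (λ e' → inH X e' ∧ does (φ e' ≟ e)) (allFin m))

Σᶠ : (k : ℕ) → (Fin k → ℤ) → ℤ
Σᶠ zero f = + 0
Σᶠ (suc k) f = f zero + Σᶠ k (λ j → f (suc j))

perm : (k : ℕ) → (Fin k → Fin k → ℤ) → ℤ
perm zero M = + 1
perm (suc k) M = Σᶠ (suc k) (λ j → M zero j * perm k (λ i j' → M (suc i) (punchIn j j')))

module _ (G : Graph) where
  open Graph G

  -- H has a permanent-non-singular (0,2)-matrix A_H(η) (η = 0 on vertices,
  -- η(e) ≤ 2 on edges, η = 0 off E(H)) with no column indexed by an E[X,Y]
  -- edge, i.e. η supported on E[X].
  HasGoodMatrix : (Fin n → Bool) → (Fin m → Bool) → Set
  HasGoodMatrix X o =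
    Σ (Fin m → ℕ) λ η →
      (∀ e → η e ≤ 2) ×
      (∀ e → inEX G X e ≡ false → η e ≡ 0) ×
      Σ (length (colsη G η) ≡ length (rowsH G X)) λ sq →
        ¬ (perm (length (rowsH G X))
             (λ i j → entryA G o (lookup (rowsH G X) i)
                                 (lookup (colsη G η) (cast (sym sq) j)))
           ≡ + 0)

-- Take η(e) = |φ⁻¹(e)|. The rows of A_H(η) (the edges of H) and its columns (each e ∈ E[X]
-- repeated |φ⁻¹(e)| times) then form the same multiset after applying φ to the rows, so φ
-- induces a bijection σ from rows to columns, and the entry A_H[e, φ(e)] is nonzero because
-- φ(e) shares an end with e and is a source or sink edge. The column of a source (sink) edge
-- has all entries in {0, -1} ({0, 1}); multiplying each column by its sign makes every term
-- of the permanent nonnegative, and the term of σ positive.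
module Submission where

open import Defs
open import Data.Nat using (ℕ; _≤_)
open import Data.Fin using (Fin)
open import Data.Bool using (Bool; true)
open import Data.Product using (_×_)
open import Data.Sum using (_⊎_)
open import Relation.Binary.PropositionalEquality using (_≡_; _≢_)

import Algebra.Properties.CommutativeMonoid.Sum as CommutativeMonoidSum
open import Data.Bool using (false; _∧_; if_then_else_)
open import Data.Bool.Properties using (T-≡)
import Data.Nat as ℕ
open import Data.Nat using (zero; suc; z≤n; s≤s)
import Data.Nat.Properties as ℕₚ
open import Data.Fin using (zero; suc; punchIn; punchOut; cast; _≟_)
import Data.Fin.Properties as Finₚ
open import Data.Integer using (ℤ; +_; +[1+_]; 0ℤ; _◃_; _+_; _*_)
import Data.Integer.Properties as ℤₚ
open import Data.Integer.Solver using (module +-*-Solver)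
open import Data.List using (List; []; _∷_; _++_; filterᵇ; length; lookup; allFin; tabulate; replicate; concatMap)
import Data.List.Properties as Listₚ
open import Data.List.Membership.Propositional.Properties using (∈-filter⁻; ∈-lookup)
open import Data.Product using (∃; _,_; proj₁; proj₂)
open import Data.Sign using (Sign)
open import Data.Sum using (inj₁; inj₂)
open import Function using (_∘_)
open import Function.Bundles using (Equivalence)
open import Function.Definitions using (Injective)
open import Relation.Binary.Definitions using (DecidableEquality)
open import Relation.Binary.PropositionalEquality using (refl; sym; trans; cong; cong₂; subst; module ≡-Reasoning)
open import Relation.Nullary using (¬_; Dec; does; yes; no; contradiction)
open import Relation.Nullary.Decidable using (_⊎-dec_; T?)

open module ℕSum = CommutativeMonoidSum ℕₚ.+-0-commutativeMonoid using () renaming (sum to ∑)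
open module ℤProduct = CommutativeMonoidSum ℤₚ.*-1-commutativeMonoid using () renaming (sum to ∏)

Σᶠ-cong : ∀ k {f g : Fin k → ℤ} → (∀ j → f j ≡ g j) → Σᶠ k f ≡ Σᶠ k g
Σᶠ-cong zero    eq = refl
Σᶠ-cong (suc k) eq = cong₂ _+_ (eq zero) (Σᶠ-cong k (eq ∘ suc))

*-distribˡ-Σᶠ : ∀ k c (f : Fin k → ℤ) → c * Σᶠ k f ≡ Σᶠ k (λ j → c * f j)
*-distribˡ-Σᶠ zero    c f = ℤₚ.*-zeroʳ c
*-distribˡ-Σᶠ (suc k) c f =
  trans (ℤₚ.*-distribˡ-+ c (f zero) _) (cong (λ x → c * f zero + x) (*-distribˡ-Σᶠ k c (f ∘ suc)))

perm-cong : ∀ k {M N : Fin k → Fin k → ℤ} → (∀ i j → M i j ≡ N i j) → perm k M ≡ perm k N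
perm-cong zero    eq = refl
perm-cong (suc k) eq =
  Σᶠ-cong (suc k) (λ j → cong₂ _*_ (eq zero j) (perm-cong k (λ i j′ → eq (suc i) (punchIn j j′))))

perm-scaleColumns : ∀ k (s : Fin k → ℤ) (M : Fin k → Fin k → ℤ) →
  perm k (λ i j → s j * M i j) ≡ ∏ s * perm k M
perm-scaleColumns zero    s M = refl
perm-scaleColumns (suc k) s M = begin
  Σᶠ (suc k) (λ j → (s j * M zero j) * perm k (λ i j′ → s (punchIn j j′) * minor j i j′))
    ≡⟨ Σᶠ-cong (suc k) (λ j → cong ((s j * M zero j) *_)
                                     (perm-scaleColumns k (s ∘ punchIn j) (minor j))) ⟩
  Σᶠ (suc k) (λ j → (s j * M zero j) * (∏ (s ∘ punchIn j) * perm k (minor j)))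
    ≡⟨ Σᶠ-cong (suc k) (λ j → trans (regroup (s j) (M zero j) (∏ (s ∘ punchIn j)) (perm k (minor j)))
                                     (cong (_* (M zero j * perm k (minor j))) (sym (ℤProduct.sum-remove {i = j} s)))) ⟩
  Σᶠ (suc k) (λ j → ∏ s * (M zero j * perm k (minor j)))
    ≡⟨ *-distribˡ-Σᶠ (suc k) (∏ s) (λ j → M zero j * perm k (minor j)) ⟨
  ∏ s * perm (suc k) M ∎
  where
  open ≡-Reasoning
  open +-*-Solver
  minor : Fin (suc k) → Fin k → Fin k → ℤ
  minor j i j′ = M (suc i) (punchIn j j′)
  regroup : ∀ a b c d → (a * b) * (c * d) ≡ (a * c) * (b * d)
  regroup = solve 4 (λ a b c d → (a :* b) :* (c :* d) := (a :* c) :* (b :* d)) refl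

NonNeg : ℤ → Set
NonNeg x = ∃ λ n → x ≡ + n

Pos : ℤ → Set
Pos x = ∃ λ n → x ≡ +[1+ n ]

Pos⇒≢0 : ∀ {x} → Pos x → x ≢ 0ℤ
Pos⇒≢0 (n , refl) ()

*-nonNeg : ∀ {x y} → NonNeg x → NonNeg y → NonNeg (x * y)
*-nonNeg (a , refl) (b , refl) = a ℕ.* b , sym (ℤₚ.pos-* a b)

*-pos : ∀ {x y} → Pos x → Pos y → Pos (x * y)
*-pos (a , refl) (b , refl) = b ℕ.+ a ℕ.* suc b , refl

Σᶠ-nonNeg : ∀ k (f : Fin k → ℤ) → (∀ j → NonNeg (f j)) → NonNeg (Σᶠ k f)
Σᶠ-nonNeg zero    f f≥0 = 0 , refl
Σᶠ-nonNeg (suc k) f f≥0 with f≥0 zero | Σᶠ-nonNeg k (f ∘ suc) (f≥0 ∘ suc)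
... | a , fa | b , rest = a ℕ.+ b , cong₂ _+_ fa rest

Σᶠ-pos : ∀ k (f : Fin k → ℤ) p → (∀ j → NonNeg (f j)) → Pos (f p) → Pos (Σᶠ k f)
Σᶠ-pos (suc k) f zero f≥0 (a , fa) with Σᶠ-nonNeg k (f ∘ suc) (f≥0 ∘ suc)
... | b , rest = a ℕ.+ b , cong₂ _+_ fa rest
Σᶠ-pos (suc k) f (suc p) f≥0 fp>0 with f≥0 zero | Σᶠ-pos k (f ∘ suc) p (f≥0 ∘ suc) fp>0
... | a , fa | b , rest = a ℕ.+ b , trans (cong₂ _+_ fa rest) (cong +_ (ℕₚ.+-suc a b))

perm-nonNeg : ∀ k (C : Fin k → Fin k → ℤ) → (∀ i j → NonNeg (C i j)) → NonNeg (perm k C)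
perm-nonNeg zero    C C≥0 = 1 , refl
perm-nonNeg (suc k) C C≥0 =
  Σᶠ-nonNeg (suc k) _ (λ j → *-nonNeg (C≥0 zero j) (perm-nonNeg k _ (λ i j′ → C≥0 (suc i) (punchIn j j′))))

-- The transversal σ survives into the minor of its first entry, re-indexed by punchOut.
perm-pos : ∀ k (C : Fin k → Fin k → ℤ) (σ : Fin k → Fin k) → Injective _≡_ _≡_ σ →
  (∀ i j → NonNeg (C i j)) → (∀ i → Pos (C i (σ i))) → Pos (perm k C)
perm-pos zero    C σ σ-inj C≥0 Cσ>0 = 0 , refl
perm-pos (suc k) C σ σ-inj C≥0 Cσ>0 =
  Σᶠ-pos (suc k) _ (σ zero)
    (λ j → *-nonNeg (C≥0 zero j) (perm-nonNeg k _ (λ i j′ → C≥0 (suc i) (punchIn j j′))))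
    (*-pos (Cσ>0 zero) (perm-pos k _ σ′ σ′-inj (λ i j′ → C≥0 (suc i) (punchIn (σ zero) j′)) Cσ′>0))
  where
  σ0≢σsuc : ∀ i → σ zero ≢ σ (suc i)
  σ0≢σsuc i eq with σ-inj eq
  ... | ()
  σ′ : Fin k → Fin k
  σ′ i = punchOut (σ0≢σsuc i)
  σ′-inj : Injective _≡_ _≡_ σ′
  σ′-inj {i} {j} eq = Finₚ.suc-injective (σ-inj (Finₚ.punchOut-injective (σ0≢σsuc i) (σ0≢σsuc j) eq))
  Cσ′>0 : ∀ i → Pos (C (suc i) (punchIn (σ zero) (σ′ i)))
  Cσ′>0 i = subst (Pos ∘ C (suc i)) (sym (Finₚ.punchIn-punchOut (σ0≢σsuc i))) (Cσ>0 (suc i))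

SignedColumn : ∀ {k k′} → (Fin k → Fin k′ → ℤ) → Fin k′ → Set
SignedColumn N j = ∃ λ (s : Sign) → ∀ i → N i j ≡ 0ℤ ⊎ N i j ≡ s ◃ 1

signed-nonNeg : ∀ s {x} → x ≡ 0ℤ ⊎ x ≡ s ◃ 1 → NonNeg ((s ◃ 1) * x)
signed-nonNeg s      (inj₁ refl) = 0 , ℤₚ.*-zeroʳ (s ◃ 1)
signed-nonNeg Sign.+ (inj₂ refl) = 1 , refl
signed-nonNeg Sign.- (inj₂ refl) = 1 , refl

signed-pos : ∀ s {x} → x ≢ 0ℤ → x ≡ 0ℤ ⊎ x ≡ s ◃ 1 → Pos ((s ◃ 1) * x)
signed-pos s      x≢0 (inj₁ x≡0) = contradiction x≡0 x≢0
signed-pos Sign.+ x≢0 (inj₂ refl) = 0 , refl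
signed-pos Sign.- x≢0 (inj₂ refl) = 0 , refl

perm≢0 : ∀ k (M : Fin k → Fin k → ℤ) → (∀ j → SignedColumn M j) →
  (σ : Fin k → Fin k) → Injective _≡_ _≡_ σ → (∀ i → M i (σ i) ≢ 0ℤ) → perm k M ≢ 0ℤ
perm≢0 k M signed σ σ-inj Mσ≢0 perm≡0 = Pos⇒≢0 scaled>0 (begin
  perm k (λ i j → s j * M i j) ≡⟨ perm-scaleColumns k s M ⟩
  ∏ s * perm k M               ≡⟨ cong (∏ s *_) perm≡0 ⟩
  ∏ s * 0ℤ                     ≡⟨ ℤₚ.*-zeroʳ (∏ s) ⟩
  0ℤ                           ∎)
  where
  open ≡-Reasoning
  s : Fin k → ℤ
  s j = proj₁ (signed j) ◃ 1
  scaled>0 : Pos (perm k (λ i j → s j * M i j))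
  scaled>0 = perm-pos k _ σ σ-inj
    (λ i j → signed-nonNeg (proj₁ (signed j)) (proj₂ (signed j) i))
    (λ i → signed-pos (proj₁ (signed (σ i))) (Mσ≢0 i) (proj₂ (signed (σ i)) i))

perm-cast≢0 : ∀ {k k′} (N : Fin k → Fin k′ → ℤ) (k′≡k : k′ ≡ k) → (∀ j → SignedColumn N j) →
  (σ : Fin k → Fin k′) → Injective _≡_ _≡_ σ → (∀ i → N i (σ i) ≢ 0ℤ) →
  perm k (λ i j → N i (cast (sym k′≡k) j)) ≢ 0ℤ
perm-cast≢0 {k} N refl signed σ σ-inj Nσ≢0 =
  subst (_≢ 0ℤ) (perm-cong k (λ i j → cong (N i) (sym (Finₚ.cast-is-id refl j))))
    (perm≢0 k N signed σ σ-inj Nσ≢0)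

countᵇ : ∀ {k} → (Fin k → Bool) → ℕ
countᵇ q = ∑ (λ i → if q i then 1 else 0)

countᵇ-lookup : ∀ {B : Set} (p : B → Bool) (xs : List B) → countᵇ (p ∘ lookup xs) ≡ length (filterᵇ p xs)
countᵇ-lookup p []       = refl
countᵇ-lookup p (x ∷ xs) with p x
... | true  = cong suc (countᵇ-lookup p xs)
... | false = countᵇ-lookup p xs

length-filterᵇ-tabulate : ∀ {B : Set} {k} (p : B → Bool) (f : Fin k → B) →
  length (filterᵇ p (tabulate f)) ≡ countᵇ (p ∘ f)
length-filterᵇ-tabulate {k = zero}  p f = refl
length-filterᵇ-tabulate {k = suc k} p f with p (f zero)
... | true  = cong suc (length-filterᵇ-tabulate p (f ∘ suc))
... | false = length-filterᵇ-tabulate p (f ∘ suc)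

length-filterᵇ-++ : ∀ {B : Set} (p : B → Bool) xs ys →
  length (filterᵇ p (xs ++ ys)) ≡ length (filterᵇ p xs) ℕ.+ length (filterᵇ p ys)
length-filterᵇ-++ p xs ys = trans (cong length (Listₚ.filter-++ (T? ∘ p) xs ys)) (Listₚ.length-++ (filterᵇ p xs))

length-filterᵇ-replicate : ∀ {B : Set} (p : B → Bool) n x →
  length (filterᵇ p (replicate n x)) ≡ (if p x then n else 0)
length-filterᵇ-replicate p zero    x with p x
... | true  = refl
... | false = refl
length-filterᵇ-replicate p (suc n) x with p x | length-filterᵇ-replicate p n x
... | true  | ih = cong suc ih
... | false | ih = ih

filterᵇ-filterᵇ : ∀ {B : Set} (p q : B → Bool) xs → filterᵇ q (filterᵇ p xs) ≡ filterᵇ (λ x → p x ∧ q x) xs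
filterᵇ-filterᵇ p q []       = refl
filterᵇ-filterᵇ p q (x ∷ xs) with p x
... | false = filterᵇ-filterᵇ p q xs
... | true with q x
...   | true  = cong (x ∷_) (filterᵇ-filterᵇ p q xs)
...   | false = filterᵇ-filterᵇ p q xs

length-filterᵇ-none : ∀ {B : Set} (p : B → Bool) → (∀ x → p x ≡ false) → ∀ xs → length (filterᵇ p xs) ≡ 0
length-filterᵇ-none p p≡false []       = refl
length-filterᵇ-none p p≡false (x ∷ xs) rewrite p≡false x = length-filterᵇ-none p p≡false xs

lookup-filterᵇ : ∀ {B : Set} (p : B → Bool) xs i → p (lookup (filterᵇ p xs) i) ≡ true
lookup-filterᵇ p xs i =
  Equivalence.to T-≡ (proj₂ (∈-filter⁻ (T? ∘ p) {xs = xs} (∈-lookup {xs = filterᵇ p xs} i)))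

module Fibres {A : Set} (_≟_ : DecidableEquality A) where

  count : ∀ {k} → (Fin k → A) → A → ℕ
  count u b = countᵇ (λ i → does (u i ≟ b))

  count-head≥1 : ∀ {k} (u : Fin (suc k) → A) → 1 ≤ count u (u zero)
  count-head≥1 u with u zero ≟ u zero
  ... | yes _ = s≤s z≤n
  ... | no u0≢u0 = contradiction refl u0≢u0

  count-pos⇒preimage : ∀ {k} (v : Fin k → A) b → 1 ≤ count v b → ∃ λ p → v p ≡ b
  count-pos⇒preimage {zero}  v b ()
  count-pos⇒preimage {suc k} v b pos with v zero ≟ b
  ... | yes v0≡b = zero , v0≡b
  ... | no _ with count-pos⇒preimage (v ∘ suc) b pos
  ...   | p , vp≡b = suc p , vp≡b

  record Embedding {k k′} (u : Fin k → A) (v : Fin k′ → A) : Set where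
    constructor embedding
    field
      to        : Fin k → Fin k′
      injective : Injective _≡_ _≡_ to
      commutes  : ∀ i → v (to i) ≡ u i

  fibres≤-punchIn : ∀ {k k′} (u : Fin (suc k) → A) (v : Fin (suc k′) → A) p → v p ≡ u zero →
    (∀ b → count u b ≤ count v b) → ∀ b → count (u ∘ suc) b ≤ count (v ∘ punchIn p) b
  fibres≤-punchIn u v p vp≡u0 u≤v b = ℕₚ.+-cancelˡ-≤ (hit (u zero)) _ _ (begin
    count u b                                  ≤⟨ u≤v b ⟩
    count v b                                  ≡⟨ ℕSum.sum-remove {i = p} (hit ∘ v) ⟩
    hit (v p) ℕ.+ count (v ∘ punchIn p) b      ≡⟨ cong (λ a → hit a ℕ.+ count (v ∘ punchIn p) b) vp≡u0 ⟩
    hit (u zero) ℕ.+ count (v ∘ punchIn p) b   ∎)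
    where
    open ℕₚ.≤-Reasoning
    hit : A → ℕ
    hit a = if does (a ≟ b) then 1 else 0

  embedding-punchIn : ∀ {k k′} (u : Fin (suc k) → A) (v : Fin (suc k′) → A) p → v p ≡ u zero →
    Embedding (u ∘ suc) (v ∘ punchIn p) → Embedding u v
  embedding-punchIn u v p vp≡u0 (embedding σ′ σ′-inj vσ′≡u) = embedding σ σ-inj vσ≡u
    where
    σ : Fin _ → Fin _
    σ zero    = p
    σ (suc i) = punchIn p (σ′ i)
    σ-inj : Injective _≡_ _≡_ σ
    σ-inj {zero}  {zero}  _  = refl
    σ-inj {zero}  {suc j} eq = contradiction (sym eq) (Finₚ.punchInᵢ≢i p (σ′ j))
    σ-inj {suc i} {zero}  eq = contradiction eq (Finₚ.punchInᵢ≢i p (σ′ i))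
    σ-inj {suc i} {suc j} eq = cong suc (σ′-inj (Finₚ.punchIn-injective p _ _ eq))
    vσ≡u : ∀ i → v (σ i) ≡ u i
    vσ≡u zero    = vp≡u0
    vσ≡u (suc i) = vσ′≡u i

  fibres≤⇒embedding : ∀ {k k′} (u : Fin k → A) (v : Fin k′ → A) →
    (∀ b → count u b ≤ count v b) → Embedding u v
  fibres≤⇒embedding {zero}       u v u≤v = embedding (λ ()) (λ { {()} }) (λ ())
  fibres≤⇒embedding {suc k} {k′} u v u≤v
    with count-pos⇒preimage v (u zero) (ℕₚ.≤-trans (count-head≥1 u) (u≤v (u zero)))
  ... | p , vp≡u0 with k′
  -- p : Fin k′ rules out k′ = 0.
  ...   | suc _ = embedding-punchIn u v p vp≡u0
                    (fibres≤⇒embedding (u ∘ suc) (v ∘ punchIn p) (fibres≤-punchIn u v p vp≡u0 u≤v))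

  count-replicates : (n : A → ℕ) (xs : List A) (b : A) →
    length (filterᵇ (λ x → does (x ≟ b)) (concatMap (λ x → replicate (n x) x) xs))
      ≡ length (filterᵇ (λ x → does (x ≟ b)) xs) ℕ.* n b
  count-replicates n []       b = refl
  count-replicates n (x ∷ xs) b = begin
    length (filterᵇ isB (replicate (n x) x ++ concatMap (λ y → replicate (n y) y) xs))
      ≡⟨ length-filterᵇ-++ isB (replicate (n x) x) _ ⟩
    length (filterᵇ isB (replicate (n x) x)) ℕ.+ length (filterᵇ isB (concatMap (λ y → replicate (n y) y) xs))
      ≡⟨ cong₂ ℕ._+_ (length-filterᵇ-replicate isB (n x) x) (count-replicates n xs b) ⟩
    (if isB x then n x else 0) ℕ.+ length (filterᵇ isB xs) ℕ.* n b
      ≡⟨ head-term ⟩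
    length (filterᵇ isB (x ∷ xs)) ℕ.* n b ∎
    where
    open ≡-Reasoning
    isB : A → Bool
    isB y = does (y ≟ b)
    head-term : (if isB x then n x else 0) ℕ.+ length (filterᵇ isB xs) ℕ.* n b
              ≡ length (filterᵇ isB (x ∷ xs)) ℕ.* n b
    head-term with x ≟ b
    ... | yes refl = refl
    ... | no _     = refl

module FinFibres {m : ℕ} = Fibres (_≟_ {m})
open FinFibres

count-id : ∀ {m} (b : Fin m) → count (λ i → i) b ≡ 1
count-id {suc m} zero    = cong suc (ℕSum.sum-replicate-zero m)
count-id {suc m} (suc b) = count-id b

count-replicates-allFin : ∀ {m} (n : Fin m → ℕ) b →
  count (lookup (concatMap (λ e → replicate (n e) e) (allFin m))) b ≡ n b
count-replicates-allFin {m} n b = begin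
  count (lookup (concatMap (λ e → replicate (n e) e) (allFin m))) b
    ≡⟨ countᵇ-lookup _ (concatMap (λ e → replicate (n e) e) (allFin m)) ⟩
  length (filterᵇ (λ x → does (x ≟ b)) (concatMap (λ e → replicate (n e) e) (allFin m)))
    ≡⟨ count-replicates n (allFin m) b ⟩
  length (filterᵇ (λ x → does (x ≟ b)) (allFin m)) ℕ.* n b
    ≡⟨ cong (ℕ._* n b) (length-filterᵇ-tabulate (λ x → does (x ≟ b)) (λ (i : Fin m) → i)) ⟩
  count (λ i → i) b ℕ.* n b
    ≡⟨ cong (ℕ._* n b) (count-id b) ⟩
  1 ℕ.* n b
    ≡⟨ ℕₚ.*-identityˡ (n b) ⟩
  n b ∎
  where open ≡-Reasoning

module _ (G : Graph) (X : Fin (Graph.n G) → Bool) (o : Fin (Graph.m G) → Bool) where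
  open Graph G

  incident? : ∀ v e → Dec (Incident G v e)
  incident? v e = (proj₁ (ends e) ≟ v) ⊎-dec (proj₂ (ends e) ≟ v)

  headO-incident : ∀ e → Incident G (headO G o e) e
  headO-incident e with o e
  ... | true  = inj₂ refl
  ... | false = inj₁ refl

  tailO-incident : ∀ e → Incident G (tailO G o e) e
  tailO-incident e with o e
  ... | true  = inj₁ refl
  ... | false = inj₂ refl

  tailO≢headO : ∀ e → tailO G o e ≢ headO G o e
  tailO≢headO e with o e
  ... | true  = loopless e
  ... | false = loopless e ∘ sym

  source-headO-free : ∀ {e f} → inH G X e ≡ true → e ≢ f → SourceEdge G X o f → ¬ Incident G (headO G o e) f
  source-headO-free {e} e∈H e≢f src head∈f = tailO≢headO e (src e _ e∈H e≢f head∈f (headO-incident e))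

  sink-tailO-free : ∀ {e f} → inH G X e ≡ true → e ≢ f → SinkEdge G X o f → ¬ Incident G (tailO G o e) f
  sink-tailO-free {e} e∈H e≢f snk tail∈f = tailO≢headO e (sym (snk e _ e∈H e≢f tail∈f (tailO-incident e)))

  source-shares-tailO : ∀ {e f} → inH G X e ≡ true → e ≢ f → ShareEnd G e f → SourceEdge G X o f →
    Incident G (tailO G o e) f
  source-shares-tailO {e} {f} e∈H e≢f (w , w∈e , w∈f) src =
    subst (λ v → Incident G v f) (sym (src e w e∈H e≢f w∈f w∈e)) w∈f

  sink-shares-headO : ∀ {e f} → inH G X e ≡ true → e ≢ f → ShareEnd G e f → SinkEdge G X o f →
    Incident G (headO G o e) f
  sink-shares-headO {e} {f} e∈H e≢f (w , w∈e , w∈f) snk =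
    subst (λ v → Incident G v f) (sym (snk e w e∈H e≢f w∈f w∈e)) w∈f

  -- entryA branches on booleans; since incidentᵇ v f is definitionally does (incident? v f),
  -- this view recovers the incidence evidence behind each branch.
  data EntryView (e f : Fin m) : ℤ → Set where
    diagonal : e ≡ f → EntryView e f 0ℤ
    head-hit : e ≢ f → Incident G (headO G o e) f → EntryView e f (+ 1)
    tail-hit : e ≢ f → ¬ Incident G (headO G o e) f → Incident G (tailO G o e) f → EntryView e f (Sign.- ◃ 1)
    miss     : e ≢ f → ¬ Incident G (headO G o e) f → ¬ Incident G (tailO G o e) f → EntryView e f 0ℤ

  entryView : ∀ e f → EntryView e f (entryA G o e f)
  entryView e f = view (e ≟ f) (incident? (headO G o e) f) (incident? (tailO G o e) f)
    where
    view : (e≟f : Dec (e ≡ f)) (head? : Dec (Incident G (headO G o e) f))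
      (tail? : Dec (Incident G (tailO G o e) f)) →
      EntryView e f (if does e≟f then + 0 else if does head? then + 1 else if does tail? then Sign.- ◃ 1 else + 0)
    view (yes e≡f) _              _              = diagonal e≡f
    view (no e≢f)  (yes head∈f)   _              = head-hit e≢f head∈f
    view (no e≢f)  (no head∉f)    (yes tail∈f)   = tail-hit e≢f head∉f tail∈f
    view (no e≢f)  (no head∉f)    (no tail∉f)    = miss e≢f head∉f tail∉f

  entryA-source : ∀ {e f} → inH G X e ≡ true → SourceEdge G X o f →
    entryA G o e f ≡ 0ℤ ⊎ entryA G o e f ≡ Sign.- ◃ 1
  entryA-source {e} {f} e∈H src with entryA G o e f | entryView e f
  ... | _ | diagonal _            = inj₁ refl
  ... | _ | head-hit e≢f head∈f   = contradiction head∈f (source-headO-free e∈H e≢f src)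
  ... | _ | tail-hit _ _ _        = inj₂ refl
  ... | _ | miss _ _ _            = inj₁ refl

  entryA-sink : ∀ {e f} → inH G X e ≡ true → SinkEdge G X o f →
    entryA G o e f ≡ 0ℤ ⊎ entryA G o e f ≡ Sign.+ ◃ 1
  entryA-sink {e} {f} e∈H snk with entryA G o e f | entryView e f
  ... | _ | diagonal _            = inj₁ refl
  ... | _ | head-hit _ _          = inj₂ refl
  ... | _ | tail-hit e≢f _ tail∈f = contradiction tail∈f (sink-tailO-free e∈H e≢f snk)
  ... | _ | miss _ _ _            = inj₁ refl

  entryA-nonzero : ∀ {e f} → inH G X e ≡ true → e ≢ f → ShareEnd G e f →
    SourceEdge G X o f ⊎ SinkEdge G X o f → entryA G o e f ≢ 0ℤ
  entryA-nonzero {e} {f} e∈H e≢f shared source-or-sink with entryA G o e f | entryView e f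
  ... | _ | diagonal e≡f   = contradiction e≡f e≢f
  ... | _ | head-hit _ _   = λ ()
  ... | _ | tail-hit _ _ _ = λ ()
  ... | _ | miss _ head∉f tail∉f with source-or-sink
  ...   | inj₁ src = contradiction (source-shares-tailO e∈H e≢f shared src) tail∉f
  ...   | inj₂ snk = contradiction (sink-shares-headO e∈H e≢f shared snk) head∉f

  signedColumns : ∀ {k k′} (r : Fin k → Fin m) (c : Fin k′ → Fin m) → (∀ i → inH G X (r i) ≡ true) →
    (∀ j → SourceEdge G X o (c j) ⊎ SinkEdge G X o (c j)) →
    ∀ j → SignedColumn (λ i j → entryA G o (r i) (c j)) j
  signedColumns r c r∈H source-or-sink j with source-or-sink j
  ... | inj₁ src = Sign.- , λ i → entryA-source (r∈H i) src
  ... | inj₂ snk = Sign.+ , λ i → entryA-sink (r∈H i) snk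

SourceSinkAssignment : (G : Graph) → (Fin (Graph.n G) → Bool) → (Fin (Graph.m G) → Bool) →
  (Fin (Graph.m G) → Fin (Graph.m G)) → Set
SourceSinkAssignment G X o φ = ∀ e → inH G X e ≡ true →
  inEX G X (φ e) ≡ true × φ e ≢ e × ShareEnd G e (φ e) × (SourceEdge G X o (φ e) ⊎ SinkEdge G X o (φ e))

module Assignment (G : Graph) (X : Fin (Graph.n G) → Bool) (o : Fin (Graph.m G) → Bool)
  (φ : Fin (Graph.m G) → Fin (Graph.m G)) (φ-spec : SourceSinkAssignment G X o φ) where
  open Graph G
  open Embedding

  η : Fin m → ℕ
  η = preimageSize G X φ

  η-outside : ∀ b → inEX G X b ≡ false → η b ≡ 0
  η-outside b b∉EX = length-filterᵇ-none _ none (allFin m)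
    where
    none : ∀ e → (inH G X e ∧ does (φ e ≟ b)) ≡ false
    none e with inH G X e in e∈H | φ e ≟ b
    ... | false | _        = refl
    ... | true  | no _     = refl
    ... | true  | yes refl = contradiction (trans (sym (proj₁ (φ-spec e e∈H))) b∉EX) λ ()

  row : Fin (length (rowsH G X)) → Fin m
  row = lookup (rowsH G X)

  column : Fin (length (colsη G η)) → Fin m
  column = lookup (colsη G η)

  row∈H : ∀ i → inH G X (row i) ≡ true
  row∈H = lookup-filterᵇ (inH G X) (allFin m)

  fibres : ∀ b → count (φ ∘ row) b ≡ count column b
  fibres b = begin
    count (φ ∘ row) b
      ≡⟨ countᵇ-lookup (λ e → does (φ e ≟ b)) (rowsH G X) ⟩
    length (filterᵇ (λ e → does (φ e ≟ b)) (rowsH G X))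
      ≡⟨ cong length (filterᵇ-filterᵇ (inH G X) (λ e → does (φ e ≟ b)) (allFin m)) ⟩
    η b
      ≡⟨ count-replicates-allFin η b ⟨
    count column b ∎
    where open ≡-Reasoning

  σ : Embedding (φ ∘ row) column
  σ = fibres≤⇒embedding (φ ∘ row) column (ℕₚ.≤-reflexive ∘ fibres)

  τ : Embedding column (φ ∘ row)
  τ = fibres≤⇒embedding column (φ ∘ row) (ℕₚ.≤-reflexive ∘ sym ∘ fibres)

  square : length (colsη G η) ≡ length (rowsH G X)
  square = ℕₚ.≤-antisym (Finₚ.injective⇒≤ (injective τ)) (Finₚ.injective⇒≤ (injective σ))

  column-sourceOrSink : ∀ j → SourceEdge G X o (column j) ⊎ SinkEdge G X o (column j)
  column-sourceOrSink j = subst (λ f → SourceEdge G X o f ⊎ SinkEdge G X o f) (commutes τ j)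
    (proj₂ (proj₂ (proj₂ (φ-spec (row (to τ j)) (row∈H (to τ j))))))

  matched-entry≢0 : ∀ i → entryA G o (row i) (column (to σ i)) ≢ 0ℤ
  matched-entry≢0 i with φ-spec (row i) (row∈H i)
  ... | _ , φe≢e , shared , source-or-sink =
    subst (λ f → entryA G o (row i) f ≢ 0ℤ) (sym (commutes σ i))
      (entryA-nonzero G X o (row∈H i) (φe≢e ∘ sym) shared source-or-sink)

  nonsingular : perm (length (rowsH G X)) (λ i j → entryA G o (row i) (column (cast (sym square) j))) ≢ 0ℤ
  nonsingular = perm-cast≢0 (λ i j → entryA G o (row i) (column j)) square
    (signedColumns G X o row column row∈H column-sourceOrSink) (to σ) (injective σ) matched-entry≢0

lemma7 : (G : Graph) → Connected G →
    (X : Fin (Graph.n G) → Bool) →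
    (o : Fin (Graph.m G) → Bool) →
    (φ : Fin (Graph.m G) → Fin (Graph.m G)) →
    (∀ e → inH G X e ≡ true →
       inEX G X (φ e) ≡ true × φ e ≢ e × ShareEnd G e (φ e) ×
       (SourceEdge G X o (φ e) ⊎ SinkEdge G X o (φ e))) →
    (∀ e → inEX G X e ≡ true → preimageSize G X φ e ≤ 2) →
    HasGoodMatrix G X o
lemma7 G _ X o φ φ-spec φ-fibre≤2 = η , η≤2 , η-outside , square , nonsingular
  where
  open Assignment G X o φ φ-spec
  η≤2 : ∀ e → η e ≤ 2
  η≤2 e with inEX G X e in e∈?EX
  ... | true  = φ-fibre≤2 e e∈?EX
  ... | false = subst (_≤ 2) (sym (η-outside e e∈?EX)) z≤n
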